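{- Let $\epsilon \ge 0$ and let $G_i$ be a contracted graph obtained from the initial (all-singleton) graph $G_1$ by performing a sequence of $(1+\epsilon)$-good merges (each merge being $(1+\epsilon)$-good with respect to the graph at the moment it is performed). Then for every vertex $v$ of $G_i$, $w_{\max}(v)/M(v) \le 1+\epsilon$.
   Context: Let $G=(V,E,w)$ be a finite undirected graph with positive edge weights. A cluster is a nonempty subset of $V$. For disjoint clusters $X,Y$ define $w(X,Y)=\frac{1}{|X|\,|Y|}\sum_{xy\in E,\ x\in X,\ y\in Y} w(xy)$. Given a partition of $V$ into clusters, the contracted graph has the clusters as vertices, with an edge between $X,Y$ iff $w(X,Y)>0$, of weight $w(X,Y)$. Initially ($G_1$) every vertex is a singleton cluster. Merging two adjacent clusters $u,v$ replaces them by $u\cup v$. For a vertex $v$ of the current contracted graph, $w_{\max}(v)$ is the maximum weight of an edge incident to $v$ (0 if none). The min-merge value $M$ is defined by $M(v)=\infty$ for singleton clusters and, when $u$ and $v$ are merged, $M(u\cup v)=\min(M(u),M(v),w(u,v))$. A merge of adjacent vertices $u,v$ of the current graph is $(1+\epsilon)$-good if $\frac{\max(w_{\max}(u),w_{\max}(v))}{\min(M(u),M(v),w(u,v))}\le 1+\epsilon$, where $w_{\max}$ is computed in the current graph.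
   Formalization: The edge weights and the parameter $\epsilon$ are rational rather than real. -}

module Defs where

open import Data.Nat using (ℕ; zero; suc)
import Data.Nat as ℕ
open import Data.Integer using (+_)
open import Data.Rational using (ℚ; 0ℚ; 1ℚ; _+_; _*_; _/_; _≤_; _<_; _⊔_; _⊓_)
open import Data.Fin using (Fin)
open import Data.List using (List; []; _∷_; map; length; allFin; foldr; concatMap; _++_)
open import Data.List.Relation.Binary.Permutation.Propositional using (_↭_)
open import Data.Maybe using (Maybe; just; nothing)
open import Data.Product using (Σ; ∃; ∃-syntax; _×_; _,_)
open import Data.Unit using (⊤)
open import Relation.Binary.PropositionalEquality using (_≡_)
open import Relation.Binary.Construct.Closure.ReflexiveTransitive using (Star)

-- Weighted undirected graph on vertex set Fin n.  w i j is the weight of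
-- the edge ij, with w i j ≡ 0 meaning "no edge" (so edges have positive weight).
record WGraph (n : ℕ) : Set where
  field
    w     : Fin n → Fin n → ℚ
    sym   : ∀ i j → w i j ≡ w j i
    noLoop : ∀ i → w i i ≡ 0ℚ
    nonneg : ∀ i j → 0ℚ ≤ w i j

-- extended positive values: nothing = ∞
ℚ∞ : Set
ℚ∞ = Maybe ℚ

min∞ : ℚ∞ → ℚ∞ → ℚ∞
min∞ nothing y = y
min∞ (just x) nothing = just x
min∞ (just x) (just y) = just (x ⊓ y)

-- a vertex of the contracted graph: its set of original vertices and its min-merge value M
record Cluster (n : ℕ) : Set where
  constructor cl
  field
    members : List (Fin n)
    M       : ℚ∞
open Cluster public

-- a contracted graph: the list of its clusters (a partition of the vertex set)
State : ℕ → Set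
State n = List (Cluster n)

sumℚ : List ℚ → ℚ
sumℚ = foldr _+_ 0ℚ

divℕ : ℚ → ℕ → ℚ
divℕ q zero    = 0ℚ
divℕ q (suc k) = q * ((+ 1) / suc k)

module _ {n : ℕ} (G : WGraph n) where
  open WGraph G

  cw : Cluster n → Cluster n → ℚ
  cw X Y = divℕ (sumℚ (concatMap (λ x → map (λ y → w x y) (members Y)) (members X)))
                (length (members X) ℕ.* length (members Y))

  -- w_max(v) where `others` are the remaining vertices of the current contracted graph
  wmax : Cluster n → List (Cluster n) → ℚ
  wmax v others = foldr (λ u m → cw v u ⊔ m) 0ℚ others

  -- a ≤ (1+ε)·m with m ∈ ℚ∞ positive, i.e. a / m ≤ 1+ε (a/∞ = 0)
  RatioLe : ℚ → ℚ∞ → ℚ → Set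
  RatioLe a nothing  ε = ⊤
  RatioLe a (just m) ε = a ≤ ((1ℚ + ε) * m)

  mergeC : Cluster n → Cluster n → Cluster n
  mergeC X Y = cl (members X ++ members Y) (min∞ (min∞ (M X) (M Y)) (just (cw X Y)))

  initial : State n
  initial = map (λ i → cl (i ∷ []) nothing) (allFin n)

  data GoodMerge (ε : ℚ) : State n → State n → Set where
    merge : ∀ {s} u v rest →
            s ↭ (u ∷ v ∷ rest) →
            0ℚ < cw u v →
            RatioLe (wmax u (v ∷ rest) ⊔ wmax v (u ∷ rest))
                    (min∞ (min∞ (M u) (M v)) (just (cw u v))) ε →
            GoodMerge ε s (mergeC u v ∷ rest)

  GoodMerges : ℚ → State n → State n → Set
  GoodMerges ε = Star (GoodMerge ε)

-- Merging averages edge weights: w(u ∪ v, z) is a weighted mean of w(u, z) and w(v, z), hence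
-- at most their maximum.  So w_max(u ∪ v) ≤ max(w_max(u), w_max(v)), while every other vertex
-- keeps its M and can only lose weight on its edges.  The bound w_max ≤ (1+ε) M thus holds
-- initially (M = ∞), is established for u ∪ v by the goodness of the merge, and persists
-- for all other vertices.
module Submission where

open import Defs
open import Data.Nat using (ℕ; zero; suc)
import Data.Nat as ℕ
import Data.Nat.Properties as ℕ
open import Data.Nat.Coprimality using (1-coprimeTo) renaming (sym to coprime-sym)
open import Data.Integer using (+_)
import Data.Integer as ℤ
import Data.Integer.Properties as ℤ
open import Data.Rational using (ℚ; mkℚ; 0ℚ; 1ℚ; 1/_; _+_; _*_; _/_; _⊔_; _≤_)
open import Data.Rational.Properties
open import Data.Fin using (Fin)
open import Data.List using (List; []; _∷_; map; length; foldr; concatMap; _++_)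
import Data.List.Properties as List
open import Data.List.Membership.Propositional using (_∈_)
open import Data.List.Membership.Propositional.Properties using (∈-map⁻; ∈-∃++)
open import Data.List.Relation.Unary.Any using (here; there)
open import Data.List.Relation.Binary.Permutation.Propositional
  using (_↭_; prep; swap; ↭-sym) renaming (refl to ↭-refl; trans to ↭-trans)
open import Data.List.Relation.Binary.Permutation.Propositional.Properties
  using (∈-resp-↭; shift; drop-∷)
open import Data.Maybe using (just; nothing)
open import Data.Product using (∃; _,_)
open import Data.Unit using (tt)
open import Relation.Binary.PropositionalEquality
import Relation.Binary.Construct.Closure.ReflexiveTransitive as Star
import Algebra.Bundles as Bundles
import Algebra.Properties.CommutativeSemigroup as CommSemigroupProperties

open CommSemigroupProperties (Bundles.CommutativeMonoid.commutativeSemigroup +-0-commutativeMonoid)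
  using () renaming (interchange to +-interchange)
open CommSemigroupProperties ⊔-commutativeSemigroup
  using () renaming (interchange to ⊔-interchange)

toℚ : ℕ → ℚ
toℚ n = mkℚ (+ n) 0 (coprime-sym (1-coprimeTo n))

toℚ-+ : ∀ m n → toℚ (m ℕ.+ n) ≡ toℚ m + toℚ n
toℚ-+ m n = trans (sym (↥p/↧p≡p (toℚ (m ℕ.+ n))))
  (/-cong (cong₂ ℤ._+_ (sym (ℤ.*-identityʳ (+ m))) (sym (ℤ.*-identityʳ (+ n)))) refl)

divℕ-*-toℚ : ∀ q k → divℕ q (suc k) * toℚ (suc k) ≡ q
divℕ-*-toℚ q k = begin
  q * ((+ 1) / suc k) * toℚ (suc k)    ≡⟨ *-assoc q _ _ ⟩
  q * ((+ 1) / suc k * toℚ (suc k))    ≡⟨ cong (λ r → q * (r * toℚ (suc k))) (↥p/↧p≡p (1/ toℚ (suc k))) ⟩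
  q * (1/ toℚ (suc k) * toℚ (suc k))   ≡⟨ cong (q *_) (*-inverseˡ (toℚ (suc k))) ⟩
  q * 1ℚ                               ≡⟨ *-identityʳ q ⟩
  q                                    ∎
  where open ≡-Reasoning

divℕ-+-suc-≤-⊔ : ∀ a b p q → divℕ (a + b) (suc p ℕ.+ suc q) ≤ divℕ a (suc p) ⊔ divℕ b (suc q)
divℕ-+-suc-≤-⊔ a b p q = *-cancelʳ-≤-pos (toℚ (suc p ℕ.+ suc q)) (begin
  divℕ (a + b) (suc p ℕ.+ suc q) * toℚ (suc p ℕ.+ suc q)
    ≡⟨ divℕ-*-toℚ (a + b) (p ℕ.+ suc q) ⟩
  a + b
    ≡⟨ cong₂ _+_ (divℕ-*-toℚ a p) (divℕ-*-toℚ b q) ⟨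
  A * toℚ (suc p) + B * toℚ (suc q)
    ≤⟨ +-mono-≤ (*-monoʳ-≤-nonNeg (toℚ (suc p)) (p≤p⊔q A B))
                (*-monoʳ-≤-nonNeg (toℚ (suc q)) (p≤q⊔p A B)) ⟩
  (A ⊔ B) * toℚ (suc p) + (A ⊔ B) * toℚ (suc q)
    ≡⟨ *-distribˡ-+ (A ⊔ B) (toℚ (suc p)) (toℚ (suc q)) ⟨
  (A ⊔ B) * (toℚ (suc p) + toℚ (suc q))
    ≡⟨ cong ((A ⊔ B) *_) (toℚ-+ (suc p) (suc q)) ⟨
  (A ⊔ B) * toℚ (suc p ℕ.+ suc q) ∎)
  where
  open ≤-Reasoning
  A = divℕ a (suc p)
  B = divℕ b (suc q)

-- The hypotheses rule out the junk value divℕ a 0 = 0 hiding a nonzero sum a.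
divℕ-+-≤-⊔ : ∀ a b P Q → (P ≡ 0 → a ≡ 0ℚ) → (Q ≡ 0 → b ≡ 0ℚ) →
             divℕ (a + b) (P ℕ.+ Q) ≤ divℕ a P ⊔ divℕ b Q
divℕ-+-≤-⊔ a b zero Q a≡0 _ rewrite a≡0 refl | +-identityˡ b = p≤q⊔p 0ℚ (divℕ b Q)
divℕ-+-≤-⊔ a b (suc p) zero _ b≡0 rewrite b≡0 refl | +-identityʳ a | ℕ.+-identityʳ p =
  p≤p⊔q (divℕ a (suc p)) 0ℚ
divℕ-+-≤-⊔ a b (suc p) (suc q) _ _ = divℕ-+-suc-≤-⊔ a b p q

sumℚ-++ : ∀ xs ys → sumℚ (xs ++ ys) ≡ sumℚ xs + sumℚ ys
sumℚ-++ []       ys = sym (+-identityˡ (sumℚ ys))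
sumℚ-++ (x ∷ xs) ys = trans (cong (λ z → x + z) (sumℚ-++ xs ys)) (sym (+-assoc x (sumℚ xs) (sumℚ ys)))

module _ {a} {A : Set a} where

  maxOver : (A → ℚ) → ℚ → List A → ℚ
  maxOver f b = foldr (λ x m → f x ⊔ m) b

  maxOver-↭ : ∀ f b {xs ys} → xs ↭ ys → maxOver f b xs ≡ maxOver f b ys
  maxOver-↭ f b ↭-refl          = refl
  maxOver-↭ f b (prep x p)      = cong (f x ⊔_) (maxOver-↭ f b p)
  maxOver-↭ f b (swap {xs} {ys} x y p) = begin
    f x ⊔ (f y ⊔ maxOver f b xs)  ≡⟨ ⊔-assoc (f x) (f y) _ ⟨
    (f x ⊔ f y) ⊔ maxOver f b xs  ≡⟨ cong₂ _⊔_ (⊔-comm (f x) (f y)) (maxOver-↭ f b p) ⟩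
    (f y ⊔ f x) ⊔ maxOver f b ys  ≡⟨ ⊔-assoc (f y) (f x) _ ⟩
    f y ⊔ (f x ⊔ maxOver f b ys)  ∎
    where open ≡-Reasoning
  maxOver-↭ f b (↭-trans p q)   = trans (maxOver-↭ f b p) (maxOver-↭ f b q)

  maxOver-≤-⊔ : ∀ {f} g h b → (∀ x → f x ≤ g x ⊔ h x) →
                ∀ xs → maxOver f b xs ≤ maxOver g b xs ⊔ maxOver h b xs
  maxOver-≤-⊔ g h b f≤g⊔h []       = ≤-reflexive (sym (⊔-idem b))
  maxOver-≤-⊔ {f} g h b f≤g⊔h (x ∷ xs) = begin
    f x ⊔ maxOver f b xs
      ≤⟨ ⊔-mono-≤ (f≤g⊔h x) (maxOver-≤-⊔ g h b f≤g⊔h xs) ⟩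
    (g x ⊔ h x) ⊔ (maxOver g b xs ⊔ maxOver h b xs)
      ≡⟨ ⊔-interchange (g x) (h x) _ _ ⟩
    (g x ⊔ maxOver g b xs) ⊔ (h x ⊔ maxOver h b xs) ∎
    where open ≤-Reasoning

∈⇒↭∷ : ∀ {a} {A : Set a} {x : A} {xs} → x ∈ xs → ∃ λ ys → xs ↭ x ∷ ys
∈⇒↭∷ {x = x} x∈xs with ∈-∃++ x∈xs
... | ys , zs , refl = ys ++ zs , shift x ys zs

module _ {n : ℕ} (G : WGraph n) where
  open WGraph G using (w)

  rowWeight : Fin n → List (Fin n) → ℚ
  rowWeight x ys = sumℚ (map (w x) ys)

  pairWeight : List (Fin n) → List (Fin n) → ℚ
  pairWeight xs ys = sumℚ (concatMap (λ x → map (w x) ys) xs)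

  pairWeight-∷ : ∀ x xs ys → pairWeight (x ∷ xs) ys ≡ rowWeight x ys + pairWeight xs ys
  pairWeight-∷ x xs ys = sumℚ-++ (map (w x) ys) (concatMap (λ x′ → map (w x′) ys) xs)

  pairWeight-++ˡ : ∀ xs xs′ ys → pairWeight (xs ++ xs′) ys ≡ pairWeight xs ys + pairWeight xs′ ys
  pairWeight-++ˡ xs xs′ ys = trans (cong sumℚ (List.concatMap-++ row xs xs′)) (sumℚ-++ (concatMap row xs) _)
    where
    row : Fin n → List ℚ
    row x = map (w x) ys

  pairWeight-++ʳ : ∀ xs ys ys′ → pairWeight xs (ys ++ ys′) ≡ pairWeight xs ys + pairWeight xs ys′
  pairWeight-++ʳ []       ys ys′ = sym (+-identityˡ 0ℚ)
  pairWeight-++ʳ (x ∷ xs) ys ys′ = begin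
    pairWeight (x ∷ xs) (ys ++ ys′)
      ≡⟨ pairWeight-∷ x xs (ys ++ ys′) ⟩
    rowWeight x (ys ++ ys′) + pairWeight xs (ys ++ ys′)
      ≡⟨ cong₂ _+_ (trans (cong sumℚ (List.map-++ (w x) ys ys′)) (sumℚ-++ (map (w x) ys) (map (w x) ys′)))
                   (pairWeight-++ʳ xs ys ys′) ⟩
    (rowWeight x ys + rowWeight x ys′) + (pairWeight xs ys + pairWeight xs ys′)
      ≡⟨ +-interchange (rowWeight x ys) (rowWeight x ys′) (pairWeight xs ys) (pairWeight xs ys′) ⟩
    (rowWeight x ys + pairWeight xs ys) + (rowWeight x ys′ + pairWeight xs ys′)
      ≡⟨ cong₂ _+_ (pairWeight-∷ x xs ys) (pairWeight-∷ x xs ys′) ⟨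
    pairWeight (x ∷ xs) ys + pairWeight (x ∷ xs) ys′ ∎
    where open ≡-Reasoning

  pairWeight-[]ʳ : ∀ xs → pairWeight xs [] ≡ 0ℚ
  pairWeight-[]ʳ []       = refl
  pairWeight-[]ʳ (x ∷ xs) = pairWeight-[]ʳ xs

  pairWeight-noPairs : ∀ xs ys → length xs ℕ.* length ys ≡ 0 → pairWeight xs ys ≡ 0ℚ
  pairWeight-noPairs []       ys       _  = refl
  pairWeight-noPairs (x ∷ xs) []       _  = pairWeight-[]ʳ (x ∷ xs)
  pairWeight-noPairs (x ∷ xs) (y ∷ ys) ()

  cw-mergeCˡ-≤ : ∀ u v z → cw G (mergeC G u v) z ≤ cw G u z ⊔ cw G v z
  cw-mergeCˡ-≤ u v z = begin
    cw G (mergeC G u v) z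
      ≡⟨ cong₂ divℕ (pairWeight-++ˡ U V Z) size ⟩
    divℕ (pairWeight U Z + pairWeight V Z) (length U ℕ.* length Z ℕ.+ length V ℕ.* length Z)
      ≤⟨ divℕ-+-≤-⊔ _ _ _ _ (pairWeight-noPairs U Z) (pairWeight-noPairs V Z) ⟩
    cw G u z ⊔ cw G v z ∎
    where
    open ≤-Reasoning
    U = members u
    V = members v
    Z = members z
    size : length (U ++ V) ℕ.* length Z ≡ length U ℕ.* length Z ℕ.+ length V ℕ.* length Z
    size = trans (cong (ℕ._* length Z) (List.length-++ U)) (ℕ.*-distribʳ-+ (length Z) (length U) _)

  cw-mergeCʳ-≤ : ∀ u v z → cw G z (mergeC G u v) ≤ cw G z u ⊔ cw G z v
  cw-mergeCʳ-≤ u v z = begin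
    cw G z (mergeC G u v)
      ≡⟨ cong₂ divℕ (pairWeight-++ʳ Z U V) size ⟩
    divℕ (pairWeight Z U + pairWeight Z V) (length Z ℕ.* length U ℕ.+ length Z ℕ.* length V)
      ≤⟨ divℕ-+-≤-⊔ _ _ _ _ (pairWeight-noPairs Z U) (pairWeight-noPairs Z V) ⟩
    cw G z u ⊔ cw G z v ∎
    where
    open ≤-Reasoning
    U = members u
    V = members v
    Z = members z
    size : length Z ℕ.* length (U ++ V) ≡ length Z ℕ.* length U ℕ.+ length Z ℕ.* length V
    size = trans (cong (length Z ℕ.*_) (List.length-++ U)) (ℕ.*-distribˡ-+ (length Z) (length U) _)

  wmax-↭ : ∀ v {rest rest′} → rest ↭ rest′ → wmax G v rest ≡ wmax G v rest′
  wmax-↭ v = maxOver-↭ (cw G v) 0ℚ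

  wmax-mergeC-≤ : ∀ u v rest → wmax G (mergeC G u v) rest ≤ wmax G u (v ∷ rest) ⊔ wmax G v (u ∷ rest)
  wmax-mergeC-≤ u v rest = begin
    wmax G (mergeC G u v) rest       ≤⟨ maxOver-≤-⊔ (cw G u) (cw G v) 0ℚ (cw-mergeCˡ-≤ u v) rest ⟩
    wmax G u rest ⊔ wmax G v rest    ≤⟨ ⊔-mono-≤ (p≤q⊔p (cw G u v) _) (p≤q⊔p (cw G v u) _) ⟩
    wmax G u (v ∷ rest) ⊔ wmax G v (u ∷ rest) ∎
    where open ≤-Reasoning

  wmax-mergeC-≤-survivor : ∀ t u v rest → wmax G t (mergeC G u v ∷ rest) ≤ wmax G t (u ∷ v ∷ rest)
  wmax-mergeC-≤-survivor t u v rest = begin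
    cw G t (mergeC G u v) ⊔ wmax G t rest      ≤⟨ ⊔-monoˡ-≤ _ (cw-mergeCʳ-≤ u v t) ⟩
    (cw G t u ⊔ cw G t v) ⊔ wmax G t rest      ≡⟨ ⊔-assoc (cw G t u) _ _ ⟩
    cw G t u ⊔ (cw G t v ⊔ wmax G t rest)      ∎
    where open ≤-Reasoning

  RatioLe-antitone : ∀ {a b} m ε → a ≤ b → RatioLe G b m ε → RatioLe G a m ε
  RatioLe-antitone nothing  ε a≤b _   = tt
  RatioLe-antitone (just m) ε a≤b b≤m = ≤-trans a≤b b≤m

  Balanced : ℚ → State n → Set
  Balanced ε s = ∀ v rest → s ↭ v ∷ rest → RatioLe G (wmax G v rest) (M v) ε

  initial-balanced : ∀ ε → Balanced ε (initial G)
  initial-balanced ε v rest s↭ with ∈-map⁻ _ (∈-resp-↭ (↭-sym s↭) (here refl))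
  ... | _ , _ , refl = tt

  goodMerge-balanced : ∀ {ε s s′} → GoodMerge G ε s s′ → Balanced ε s → Balanced ε s′
  goodMerge-balanced {ε} (merge u v rest s↭ _ good) bal t rest′ s′↭
    with ∈-resp-↭ (↭-sym s′↭) (here refl)
  ... | here refl = RatioLe-antitone (M t) ε (begin
    wmax G t rest′   ≡⟨ wmax-↭ t (drop-∷ s′↭) ⟨
    wmax G t rest    ≤⟨ wmax-mergeC-≤ u v rest ⟩
    wmax G u (v ∷ rest) ⊔ wmax G v (u ∷ rest) ∎) good
    where open ≤-Reasoning
  ... | there t∈rest with ∈⇒↭∷ t∈rest
  ... | r , rest↭ = RatioLe-antitone (M t) ε (begin
    wmax G t rest′                  ≡⟨ wmax-↭ t rest′↭ ⟩
    wmax G t (mergeC G u v ∷ r)     ≤⟨ wmax-mergeC-≤-survivor t u v r ⟩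
    wmax G t (u ∷ v ∷ r)            ∎) (bal t (u ∷ v ∷ r) s↭t∷)
    where
    open ≤-Reasoning
    rest′↭ : rest′ ↭ mergeC G u v ∷ r
    rest′↭ = drop-∷ (↭-trans (↭-sym s′↭) (↭-trans (prep _ rest↭) (swap _ t ↭-refl)))
    s↭t∷ : _ ↭ t ∷ u ∷ v ∷ r
    s↭t∷ = ↭-trans s↭ (↭-trans (prep u (prep v rest↭)) (shift t (u ∷ v ∷ []) r))

  goodMerges-balanced : ∀ {ε s s′} → GoodMerges G ε s s′ → Balanced ε s → Balanced ε s′
  goodMerges-balanced Star.ε         bal = bal
  goodMerges-balanced (m Star.◅ ms) bal = goodMerges-balanced ms (goodMerge-balanced m bal)

lemma3p3 : ∀ {n : ℕ} (G : WGraph n) (ε : ℚ) → 0ℚ ≤ ε →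
    ∀ (s : State n) → GoodMerges G ε (initial G) s →
    ∀ (v : Cluster n) (rest : List (Cluster n)) → s ↭ (v ∷ rest) →
    RatioLe G (wmax G v rest) (M v) ε
lemma3p3 G ε _ s merges = goodMerges-balanced G merges (initial-balanced G ε)
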